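{- The Sylvester graph admits a perfect $1$-code.
   Context: The Sylvester graph is the unique distance-regular graph with intersection array $\{5,4,2;1,1,4\}$; it has $36$ vertices, valency $5$ and diameter $3$. (Intersection array $\{b_0,\dots,b_{d-1};c_1,\dots,c_d\}$: for vertices $x,y$ at distance $i$, $x$ has $b_i$ neighbours at distance $i+1$ and $c_i$ neighbours at distance $i-1$ from $y$.) A perfect $1$-code is a vertex subset $C$ such that the closed neighbourhoods of the vertices of $C$ partition the vertex set. -}

module Defs where

open import Data.Nat using (ℕ; zero; suc; _≤_)
open import Data.Bool using (Bool; true; false; _∧_; _∨_; not; T)
open import Data.Fin using (Fin; _≟_)
open import Data.List using (List; filter; length; allFin)
open import Data.Bool.ListAction using (any)
open import Data.Product using (_×_; ∃-syntax)
open import Relation.Nullary.Decidable using (⌊_⌋)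
open import Relation.Binary.PropositionalEquality using (_≡_)

record Graph (n : ℕ) : Set where
  field
    adj   : Fin n → Fin n → Bool
    sym   : ∀ x y → adj x y ≡ adj y x
    irrfl : ∀ x → adj x x ≡ false

module _ {n : ℕ} (G : Graph n) where
  open Graph G

  count : (Fin n → Bool) → ℕ
  count P = length (filter (λ v → T? (P v)) (allFin n))
    where
    open import Data.Bool.Properties using (T?)

  within : ℕ → Fin n → Fin n → Bool
  within zero    x y = ⌊ x ≟ y ⌋
  within (suc k) x y = within k x y ∨ any (λ z → adj x z ∧ within k z y) (allFin n)

  atDist : ℕ → Fin n → Fin n → Bool
  atDist zero    x y = within zero x y
  atDist (suc i) x y = within (suc i) x y ∧ not (within i x y)

  nbrsAtDist : Fin n → ℕ → Fin n → ℕ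
  nbrsAtDist x j y = count (λ z → adj x z ∧ atDist j z y)

  HasDiameter : ℕ → Set
  HasDiameter d = (∀ x y → T (within d x y)) × (∃[ x ] ∃[ y ] T (atDist d x y))

  -- G is distance-regular with intersection array {5,4,2;1,1,4}:
  -- b₀=5, b₁=4, b₂=2, c₁=1, c₂=1, c₃=4, diameter 3.
  IsDRG-5-4-2-1-1-4 : Set
  IsDRG-5-4-2-1-1-4 =
    HasDiameter 3 ×
    (∀ x y → T (atDist 0 x y) → nbrsAtDist x 1 y ≡ 5) ×
    (∀ x y → T (atDist 1 x y) → nbrsAtDist x 2 y ≡ 4 × nbrsAtDist x 0 y ≡ 1) ×
    (∀ x y → T (atDist 2 x y) → nbrsAtDist x 3 y ≡ 2 × nbrsAtDist x 1 y ≡ 1) ×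
    (∀ x y → T (atDist 3 x y) → nbrsAtDist x 2 y ≡ 4)

  IsPerfect1Code : (Fin n → Bool) → Set
  IsPerfect1Code C =
    ∀ v → count (λ c → C c ∧ (⌊ c ≟ v ⌋ ∨ adj c v)) ≡ 1

module Submission where

-- Counting walks with the intersection numbers shows that the graph has 36 vertices and that its
-- distance-3 graph Γ₃ is strongly regular with (k, λ, μ) = (10, 4, 2).  Take a Γ₃-edge xw and let
-- A = Γ₃(x) ∩ Γ₃(w) (4 vertices) and M the 5 remaining Γ₃-neighbours of x.  Each z ∈ M has at most
-- one neighbour in A (μ = 2, and x is a common neighbour of z and w), hence at least 3 in M; two
-- non-adjacent vertices of M would then share too many neighbours, so M is a clique, which leaves no
-- edges between A and M, and λ = 4 then forces A to be a clique.  So {x, w} ∪ A is a 6-clique of Γ₃: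
-- six vertices at mutual distance 3, whose closed neighbourhoods (of size 6) are disjoint and, as
-- 6 · 6 = 36, cover the graph.

open import Defs
open import Data.Nat using (ℕ)
open import Data.Bool using (Bool)
open import Data.Fin using (Fin)
open import Data.Product using (∃-syntax)

open import Data.Nat
  using (zero; suc; _+_; _*_; _≤_; _<_; _≤′_; z≤n; s≤s; ≤′-refl; ≤′-step; _≡ᵇ_; _≤?_)
open import Data.Nat.Properties hiding (_≟_)
open import Data.Bool using (true; false; _∧_; _∨_; not; T; if_then_else_)
open import Data.Bool.Properties using (T?; T-∧; T-∨; T-not-≡; ∧-comm; ∧-identityʳ)
open import Data.Fin using (zero; suc; _≟_)
import Data.Fin.Properties as Finₚ
open import Data.List using (allFin; filter; length; tabulate)
open import Data.List.Membership.Propositional using (lose)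
open import Data.List.Membership.Propositional.Properties using (∈-allFin)
open import Data.List.Relation.Unary.Any using (satisfied)
open import Data.List.Relation.Unary.Any.Properties using (any⁺; any⁻)
open import Data.Product using (_×_; _,_; proj₁; proj₂)
open import Data.Sum using (_⊎_; inj₁; inj₂)
open import Data.Vec.Functional using (Vector)
open import Data.Empty using (⊥; ⊥-elim)
open import Data.Unit using (tt)
open import Function using (_∘_)
open import Function.Bundles using (Equivalence)
open import Relation.Nullary using (¬_; yes; no)
open import Relation.Nullary.Decidable using (⌊_⌋; toWitness; fromWitness; from-no)
open import Relation.Binary.PropositionalEquality
open import Algebra.Properties.Semiring.Sum +-*-semiring
  using (sum; sum-syntax; sum-cong-≗; sum-replicate-zero; ∑-distrib-+; ∑-comm; *-distribˡ-sum)

open Equivalence using (to; from)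

-- Finite sums and counting subsets of Fin n

private variable
  n : ℕ

∑-mono-≤ : {f g : Vector ℕ n} → (∀ i → f i ≤ g i) → sum f ≤ sum g
∑-mono-≤ {zero}  f≤g = z≤n
∑-mono-≤ {suc n} f≤g = +-mono-≤ (f≤g zero) (∑-mono-≤ (λ i → f≤g (suc i)))

∑-mono-≤-equality : {f g : Vector ℕ n} → (∀ i → f i ≤ g i) → sum g ≤ sum f → ∀ i → f i ≡ g i
∑-mono-≤-equality {suc n} {f} {g} f≤g ∑g≤∑f = λ where
    zero    → ≤-antisym (f≤g zero) g₀≤f₀
    (suc i) → ∑-mono-≤-equality (λ j → f≤g (suc j)) ∑g′≤∑f′ i
  where
  ∑f′≤∑g′ : sum (f ∘ suc) ≤ sum (g ∘ suc)
  ∑f′≤∑g′ = ∑-mono-≤ (λ j → f≤g (suc j))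
  g₀≤f₀ : g zero ≤ f zero
  g₀≤f₀ = +-cancelʳ-≤ _ _ _ (≤-trans ∑g≤∑f (+-monoʳ-≤ (f zero) ∑f′≤∑g′))
  ∑g′≤∑f′ : sum (g ∘ suc) ≤ sum (f ∘ suc)
  ∑g′≤∑f′ = +-cancelˡ-≤ (g zero) _ _ (≤-trans ∑g≤∑f (+-monoˡ-≤ _ (f≤g zero)))

∑-zero : {f : Vector ℕ n} → (∀ i → f i ≡ 0) → sum f ≡ 0
∑-zero {n} f≡0 = trans (sum-cong-≗ f≡0) (sum-replicate-zero n)

Σ₄ : (ℕ → ℕ) → ℕ
Σ₄ f = f 0 + f 1 + f 2 + f 3

Σ₄-cong : ∀ {f g} → (∀ j → f j ≡ g j) → Σ₄ f ≡ Σ₄ g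
Σ₄-cong f≡g = cong₂ _+_ (cong₂ _+_ (cong₂ _+_ (f≡g 0) (f≡g 1)) (f≡g 2)) (f≡g 3)

Σ₄-*-distribʳ : ∀ f c → Σ₄ f * c ≡ Σ₄ (λ j → f j * c)
Σ₄-*-distribʳ f c rewrite *-distribʳ-+ c (f 0 + f 1 + f 2) (f 3)
                        | *-distribʳ-+ c (f 0 + f 1) (f 2)
                        | *-distribʳ-+ c (f 0) (f 1) = refl

∑-Σ₄ : (f : ℕ → Vector ℕ n) → ∑[ z < n ] Σ₄ (λ j → f j z) ≡ Σ₄ (λ j → ∑[ z < n ] f j z)
∑-Σ₄ f rewrite ∑-distrib-+ (λ z → f 0 z + f 1 z + f 2 z) (f 3)
             | ∑-distrib-+ (λ z → f 0 z + f 1 z) (f 2)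
             | ∑-distrib-+ (f 0) (f 1) = refl

¬T⇒T-not : ∀ {b} → ¬ T b → T (not b)
¬T⇒T-not {true}  ¬b = ¬b tt
¬T⇒T-not {false} _  = tt

T-not⇒¬T : ∀ {b} → T (not b) → ¬ T b
T-not⇒¬T {true} () _

𝟙 : Bool → ℕ
𝟙 true  = 1
𝟙 false = 0

𝟙-mono : ∀ {a b} → (T a → T b) → 𝟙 a ≤ 𝟙 b
𝟙-mono {false}         _   = z≤n
𝟙-mono {true} {true}   _   = ≤-refl
𝟙-mono {true} {false}  a⇒b = ⊥-elim (a⇒b tt)

𝟙-∧ : ∀ a b → 𝟙 (a ∧ b) ≡ 𝟙 a * 𝟙 b
𝟙-∧ true  b = sym (+-identityʳ (𝟙 b))
𝟙-∧ false b = refl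

∑-δ : (a : Fin n) (f : Vector ℕ n) → ∑[ v < n ] (𝟙 ⌊ v ≟ a ⌋ * f v) ≡ f a
∑-δ zero    f = trans (cong₂ _+_ (+-identityʳ (f zero)) (∑-zero {f = λ v → 0 * f (suc v)} (λ _ → refl)))
                      (+-identityʳ (f zero))
∑-δ (suc a) f = trans (sum-cong-≗ (λ v → cong (λ b → 𝟙 b * f (suc v)) (≟-suc v))) (∑-δ a (f ∘ suc))
  where
  ≟-suc : ∀ v → ⌊ suc v ≟ suc a ⌋ ≡ ⌊ v ≟ a ⌋
  ≟-suc v with v ≟ a
  ... | yes _ = refl
  ... | no  _ = refl

Pred : ℕ → Set
Pred n = Fin n → Bool

U : Pred n
U _ = true

infixr 7 _∩_
infixr 6 _∪_ _∖_
infix  4 _⊆_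

_∩_ _∪_ _∖_ : Pred n → Pred n → Pred n
(P ∩ Q) v = P v ∧ Q v
(P ∪ Q) v = P v ∨ Q v
(P ∖ Q) v = P v ∧ not (Q v)

⁅_⁆ : Fin n → Pred n
⁅ a ⁆ v = ⌊ v ≟ a ⌋

infix 4 _∈_ _∉_

-- A record rather than T (P v), so that unification can recover P from v ∈ P.
record _∈_ (v : Fin n) (P : Pred n) : Set where
  constructor mk∈
  field holds : T (P v)

open _∈_ public

_∉_ : Fin n → Pred n → Set
v ∉ P = ¬ (v ∈ P)

module _ {v : Fin n} where

  ∈∩⁺ : ∀ {P Q} → v ∈ P → v ∈ Q → v ∈ P ∩ Q
  ∈∩⁺ (mk∈ Pv) (mk∈ Qv) = mk∈ (T-∧ .from (Pv , Qv))

  ∈∩⁻ : ∀ P Q → v ∈ P ∩ Q → v ∈ P × v ∈ Q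
  ∈∩⁻ P Q (mk∈ PQv) = let (Pv , Qv) = T-∧ .to PQv in mk∈ Pv , mk∈ Qv

  ∈∪⁺ˡ : ∀ {P} Q → v ∈ P → v ∈ P ∪ Q
  ∈∪⁺ˡ Q (mk∈ Pv) = mk∈ (T-∨ .from (inj₁ Pv))

  ∈∪⁺ʳ : ∀ P {Q} → v ∈ Q → v ∈ P ∪ Q
  ∈∪⁺ʳ P (mk∈ Qv) = mk∈ (T-∨ {P v} .from (inj₂ Qv))

  ∈∪⁻ : ∀ P Q → v ∈ P ∪ Q → v ∈ P ⊎ v ∈ Q
  ∈∪⁻ P Q (mk∈ PQv) with T-∨ .to PQv
  ... | inj₁ Pv = inj₁ (mk∈ Pv)
  ... | inj₂ Qv = inj₂ (mk∈ Qv)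

  ∈∖⁺ : ∀ {P Q} → v ∈ P → v ∉ Q → v ∈ P ∖ Q
  ∈∖⁺ (mk∈ Pv) v∉Q = mk∈ (T-∧ .from (Pv , ¬T⇒T-not (v∉Q ∘ mk∈)))

  ∈∖⁻ : ∀ P Q → v ∈ P ∖ Q → v ∈ P × v ∉ Q
  ∈∖⁻ P Q (mk∈ P∖Qv) = let (Pv , Q̅v) = T-∧ .to P∖Qv in mk∈ Pv , T-not⇒¬T Q̅v ∘ holds

∉⇒false : ∀ {P : Pred n} {v} → v ∉ P → P v ≡ false
∉⇒false {P = P} {v} v∉P with P v in Pv
... | true  = ⊥-elim (v∉P (mk∈ (subst T (sym Pv) tt)))
... | false = refl

∈⇒true : ∀ {P : Pred n} {v} → v ∈ P → P v ≡ true
∈⇒true {P = P} {v} (mk∈ Pv) with P v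
... | true = refl

∈⁅⁆⁻ : ∀ {a v : Fin n} → v ∈ ⁅ a ⁆ → v ≡ a
∈⁅⁆⁻ (mk∈ v≟a) = toWitness v≟a

∈⁅⁆⁺ : ∀ {a v : Fin n} → v ≡ a → v ∈ ⁅ a ⁆
∈⁅⁆⁺ v≡a = mk∈ (fromWitness v≡a)

_⊆_ : Pred n → Pred n → Set
P ⊆ Q = ∀ v → v ∈ P → v ∈ Q

level : (Fin n → ℕ) → ℕ → Pred n
level d j z = d z ≡ᵇ j

∈level⁺ : ∀ (d : Fin n → ℕ) {j v} → d v ≡ j → v ∈ level d j
∈level⁺ d {j} {v} dv≡j = mk∈ (≡⇒≡ᵇ (d v) j dv≡j)

∈level⁻ : ∀ (d : Fin n → ℕ) {j v} → v ∈ level d j → d v ≡ j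
∈level⁻ d {j} {v} (mk∈ dv≡ᵇj) = ≡ᵇ⇒≡ (d v) j dv≡ᵇj

sumOver : Pred n → Vector ℕ n → ℕ
sumOver {n} P f = ∑[ v < n ] (𝟙 (P v) * f v)

syntax sumOver P (λ v → e) = ∑[ v ∈ P ] e

∑∈-cong : (P : Pred n) {f g : Vector ℕ n} → (∀ v → v ∈ P → f v ≡ g v) → ∑[ v ∈ P ] f v ≡ ∑[ v ∈ P ] g v
∑∈-cong P {f} {g} f≡g = sum-cong-≗ pointwise
  where
  pointwise : ∀ v → 𝟙 (P v) * f v ≡ 𝟙 (P v) * g v
  pointwise v with P v in Pv
  ... | true  = cong (_+ 0) (f≡g v (mk∈ (subst T (sym Pv) tt)))
  ... | false = refl

𝟙-by-level : (d : Fin n → ℕ) → (∀ z → d z ≤ 3) → ∀ b z → 𝟙 b ≡ Σ₄ (λ j → 𝟙 (b ∧ level d j z))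
𝟙-by-level d d≤3 false z = refl
𝟙-by-level d d≤3 true  z with d z | d≤3 z
... | 0 | _ = refl
... | 1 | _ = refl
... | 2 | _ = refl
... | 3 | _ = refl
... | suc (suc (suc (suc _))) | s≤s (s≤s (s≤s ()))

∑∈-by-level : (d : Fin n → ℕ) → (∀ z → d z ≤ 3) → (P : Pred n) (f : Vector ℕ n) →
              ∑[ z ∈ P ] f z ≡ Σ₄ (λ j → ∑[ z ∈ P ∩ level d j ] f z)
∑∈-by-level d d≤3 P f = trans (sum-cong-≗ pointwise) (∑-Σ₄ (λ j z → 𝟙 (P z ∧ level d j z) * f z))
  where
  pointwise : ∀ z → 𝟙 (P z) * f z ≡ Σ₄ (λ j → 𝟙 (P z ∧ level d j z) * f z)
  pointwise z = trans (cong (_* f z) (𝟙-by-level d d≤3 (P z) z))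
                      (Σ₄-*-distribʳ (λ j → 𝟙 (P z ∧ level d j z)) (f z))

-- Opaque for the same reason: ∣ P ∣ must not unfold, so that P can be inferred from it.
opaque

  ∣_∣ : Pred n → ℕ
  ∣_∣ {n} P = ∑[ v < n ] 𝟙 (P v)

  count≡∣∣ : (G : Graph n) (P : Pred n) → count G P ≡ ∣ P ∣
  count≡∣∣ {n} G P = length-filter-tabulate (λ i → i)
    where
    length-filter-tabulate : ∀ {m} (f : Fin m → Fin n) →
      length (filter (λ v → T? (P v)) (tabulate f)) ≡ ∑[ i < m ] 𝟙 (P (f i))
    length-filter-tabulate {zero}  f = refl
    length-filter-tabulate {suc m} f with P (f zero)
    ... | true  = cong suc (length-filter-tabulate (f ∘ suc))
    ... | false = length-filter-tabulate (f ∘ suc)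

  ∣∣-cong : {P Q : Pred n} → (∀ v → P v ≡ Q v) → ∣ P ∣ ≡ ∣ Q ∣
  ∣∣-cong P≡Q = sum-cong-≗ (λ v → cong 𝟙 (P≡Q v))

  ∣∣-mono : {P Q : Pred n} → P ⊆ Q → ∣ P ∣ ≤ ∣ Q ∣
  ∣∣-mono P⊆Q = ∑-mono-≤ (λ v → 𝟙-mono (holds ∘ P⊆Q v ∘ mk∈))

  ∣∣-cong-⊆ : {P Q : Pred n} → P ⊆ Q → Q ⊆ P → ∣ P ∣ ≡ ∣ Q ∣
  ∣∣-cong-⊆ P⊆Q Q⊆P = ≤-antisym (∣∣-mono P⊆Q) (∣∣-mono Q⊆P)

  ⊆∧∣∣≥⇒⊇ : {P Q : Pred n} → P ⊆ Q → ∣ Q ∣ ≤ ∣ P ∣ → Q ⊆ P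
  ⊆∧∣∣≥⇒⊇ {P = P} {Q} P⊆Q ∣Q∣≤∣P∣ v (mk∈ Qv) =
    mk∈ (lemma (P v) (Q v) Qv (∑-mono-≤-equality (λ v → 𝟙-mono (holds ∘ P⊆Q v ∘ mk∈)) ∣Q∣≤∣P∣ v))
    where
    lemma : ∀ p q → T q → 𝟙 p ≡ 𝟙 q → T p
    lemma true  _    _ _  = tt
    lemma false true _ ()

  ∣∣-zero : {P : Pred n} → (∀ v → v ∉ P) → ∣ P ∣ ≡ 0
  ∣∣-zero {P = P} ∉P = ∑-zero (λ v → n≤0⇒n≡0 (𝟙-mono (∉P v ∘ mk∈)))

  ∣∣-pointwise₃ : {R R₁ R₂ R₃ : Pred n} → (∀ v → 𝟙 (R v) ≡ 𝟙 (R₁ v) + 𝟙 (R₂ v) + 𝟙 (R₃ v)) →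
                  ∣ R ∣ ≡ ∣ R₁ ∣ + ∣ R₂ ∣ + ∣ R₃ ∣
  ∣∣-pointwise₃ {n} {R} {R₁} {R₂} {R₃} eq = begin
    ∣ R ∣                                            ≡⟨ sum-cong-≗ eq ⟩
    ∑[ v < n ] (𝟙 (R₁ v) + 𝟙 (R₂ v) + 𝟙 (R₃ v))       ≡⟨ ∑-distrib-+ (λ v → 𝟙 (R₁ v) + 𝟙 (R₂ v)) (𝟙 ∘ R₃) ⟩
    ∑[ v < n ] (𝟙 (R₁ v) + 𝟙 (R₂ v)) + ∣ R₃ ∣         ≡⟨ cong (_+ ∣ R₃ ∣) (∑-distrib-+ (𝟙 ∘ R₁) (𝟙 ∘ R₂)) ⟩
    ∣ R₁ ∣ + ∣ R₂ ∣ + ∣ R₃ ∣                          ∎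
    where open ≡-Reasoning

  ∣∣-∩-comm : (P Q : Pred n) → ∣ P ∩ Q ∣ ≡ ∣ Q ∩ P ∣
  ∣∣-∩-comm P Q = ∣∣-cong (λ v → ∧-comm (P v) (Q v))

  ∣∣-split : (P Q : Pred n) → ∣ P ∣ ≡ ∣ P ∩ Q ∣ + ∣ P ∖ Q ∣
  ∣∣-split P Q = trans (sum-cong-≗ pointwise) (∑-distrib-+ (𝟙 ∘ (P ∩ Q)) (𝟙 ∘ (P ∖ Q)))
    where
    pointwise : ∀ v → 𝟙 (P v) ≡ 𝟙 (P v ∧ Q v) + 𝟙 (P v ∧ not (Q v))
    pointwise v with P v | Q v
    ... | true  | true  = refl
    ... | true  | false = refl
    ... | false | _     = refl

  ∣∣-∩-∪ : (P Q : Pred n) → ∣ P ∩ Q ∣ + ∣ P ∪ Q ∣ ≡ ∣ P ∣ + ∣ Q ∣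
  ∣∣-∩-∪ P Q = begin
    ∣ P ∩ Q ∣ + ∣ P ∪ Q ∣                 ≡⟨ ∑-distrib-+ (𝟙 ∘ (P ∩ Q)) (𝟙 ∘ (P ∪ Q)) ⟨
    ∑[ v < _ ] (𝟙 ((P ∩ Q) v) + 𝟙 ((P ∪ Q) v)) ≡⟨ sum-cong-≗ pointwise ⟩
    ∑[ v < _ ] (𝟙 (P v) + 𝟙 (Q v))       ≡⟨ ∑-distrib-+ (𝟙 ∘ P) (𝟙 ∘ Q) ⟩
    ∣ P ∣ + ∣ Q ∣                         ∎
    where
    open ≡-Reasoning
    pointwise : ∀ v → 𝟙 (P v ∧ Q v) + 𝟙 (P v ∨ Q v) ≡ 𝟙 (P v) + 𝟙 (Q v)
    pointwise v with P v | Q v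
    ... | true  | true  = refl
    ... | true  | false = refl
    ... | false | true  = refl
    ... | false | false = refl

  ∣∣-disjoint-∪ : {P Q : Pred n} → (∀ v → v ∈ P → v ∈ Q → ⊥) → ∣ P ∪ Q ∣ ≡ ∣ P ∣ + ∣ Q ∣
  ∣∣-disjoint-∪ {P = P} {Q} disjoint = trans (cong (_+ ∣ P ∪ Q ∣) (sym ∣P∩Q∣≡0)) (∣∣-∩-∪ P Q)
    where
    ∣P∩Q∣≡0 : ∣ P ∩ Q ∣ ≡ 0
    ∣P∩Q∣≡0 = ∣∣-zero (λ v PQv → let (Pv , Qv) = ∈∩⁻ P Q PQv in disjoint v Pv Qv)

  ∣∩⁅⁆∣ : (P : Pred n) (a : Fin n) → ∣ P ∩ ⁅ a ⁆ ∣ ≡ 𝟙 (P a)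
  ∣∩⁅⁆∣ P a = trans (sum-cong-≗ (λ v → trans (cong 𝟙 (∧-comm (P v) _)) (𝟙-∧ _ (P v)))) (∑-δ a (𝟙 ∘ P))

  ∣⁅⁆∣ : (a : Fin n) → ∣ ⁅ a ⁆ ∣ ≡ 1
  ∣⁅⁆∣ = ∣∩⁅⁆∣ U

  ∣∣-remove : (P : Pred n) {a : Fin n} → a ∈ P → ∣ P ∣ ≡ suc ∣ P ∖ ⁅ a ⁆ ∣
  ∣∣-remove P {a} a∈P = begin
    ∣ P ∣                          ≡⟨ ∣∣-split P ⁅ a ⁆ ⟩
    ∣ P ∩ ⁅ a ⁆ ∣ + ∣ P ∖ ⁅ a ⁆ ∣    ≡⟨ cong (_+ ∣ P ∖ ⁅ a ⁆ ∣) (trans (∣∩⁅⁆∣ P a) (cong 𝟙 (∈⇒true a∈P))) ⟩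
    suc ∣ P ∖ ⁅ a ⁆ ∣              ∎
    where open ≡-Reasoning

  ∣∣-pos : (P : Pred n) {a : Fin n} → a ∈ P → 0 < ∣ P ∣
  ∣∣-pos P Pa = subst (0 <_) (sym (∣∣-remove P Pa)) (s≤s z≤n)

  ∣∣-≤1 : (P : Pred n) → (∀ a b → a ∈ P → b ∈ P → a ≡ b) → ∣ P ∣ ≤ 1
  ∣∣-≤1 {zero}  P _ = z≤n
  ∣∣-≤1 {suc n} P unique with P zero in P₀
  ... | true  = s≤s (≤-reflexive (∣∣-zero (λ v (mk∈ Psv) →
                  Finₚ.0≢1+n (unique zero (suc v) (mk∈ (subst T (sym P₀) tt)) (mk∈ Psv)))))
  ... | false = ∣∣-≤1 (P ∘ suc) (λ a b (mk∈ Pa) (mk∈ Pb) →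
                  Finₚ.suc-injective (unique (suc a) (suc b) (mk∈ Pa) (mk∈ Pb)))

  ∣U∣ : ∣ U {n} ∣ ≡ n
  ∣U∣ {zero}  = refl
  ∣U∣ {suc n} = cong suc ∣U∣

  ∑∈-const : (P : Pred n) {f : Vector ℕ n} (c : ℕ) → (∀ v → v ∈ P → f v ≡ c) → ∑[ v ∈ P ] f v ≡ c * ∣ P ∣
  ∑∈-const P {f} c f≡c = trans (sum-cong-≗ pointwise) (sym (*-distribˡ-sum c (𝟙 ∘ P)))
    where
    pointwise : ∀ v → 𝟙 (P v) * f v ≡ c * 𝟙 (P v)
    pointwise v with P v in Pv
    ... | true  = trans (+-identityʳ (f v)) (trans (f≡c v (mk∈ (subst T (sym Pv) tt))) (sym (*-identityʳ c)))
    ... | false = sym (*-zeroʳ c)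

  ∑∈-≤1-≡1 : (P : Pred n) {f : Vector ℕ n} → (∀ v → v ∈ P → f v ≤ 1) → ∣ P ∣ ≤ ∑[ v ∈ P ] f v →
             ∀ v → v ∈ P → f v ≡ 1
  ∑∈-≤1-≡1 P {f} f≤1 ∣P∣≤∑f v (mk∈ Pv) with P v in P≡ | ∑-mono-≤-equality pointwise ∣P∣≤∑f v
    where
    pointwise : ∀ v → 𝟙 (P v) * f v ≤ 𝟙 (P v)
    pointwise v with P v in Pv
    ... | true  = ≤-trans (≤-reflexive (+-identityʳ (f v))) (f≤1 v (mk∈ (subst T (sym Pv) tt)))
    ... | false = z≤n
  ... | true  | fv+0≡1 = trans (sym (+-identityʳ (f v))) fv+0≡1
  ... | false | _      = ⊥-elim (subst T P≡ Pv)

  ∑∈-swap : (E : Fin n → Pred n) → (∀ t z → E t z ≡ E z t) → (R S : Pred n) →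
            ∑[ t ∈ R ] ∣ E t ∩ S ∣ ≡ ∑[ z ∈ S ] ∣ E z ∩ R ∣
  ∑∈-swap {n} E E-sym R S = begin
    ∑[ t < n ] (𝟙 (R t) * ∣ E t ∩ S ∣)                   ≡⟨ sum-cong-≗ (λ t → *-distribˡ-sum (𝟙 (R t)) (𝟙 ∘ (E t ∩ S))) ⟩
    ∑[ t < n ] ∑[ z < n ] (𝟙 (R t) * 𝟙 (E t z ∧ S z))   ≡⟨ ∑-comm (λ t z → 𝟙 (R t) * 𝟙 (E t z ∧ S z)) ⟩
    ∑[ z < n ] ∑[ t < n ] (𝟙 (R t) * 𝟙 (E t z ∧ S z))   ≡⟨ sum-cong-≗ (λ z → sum-cong-≗ (λ t → swap t z)) ⟩
    ∑[ z < n ] ∑[ t < n ] (𝟙 (S z) * 𝟙 (E z t ∧ R t))   ≡⟨ sum-cong-≗ (λ z → *-distribˡ-sum (𝟙 (S z)) (𝟙 ∘ (E z ∩ R))) ⟨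
    ∑[ z < n ] (𝟙 (S z) * ∣ E z ∩ R ∣)                   ∎
    where
    open ≡-Reasoning
    𝟙-*-∧-swap : ∀ r e s → 𝟙 r * 𝟙 (e ∧ s) ≡ 𝟙 s * 𝟙 (e ∧ r)
    𝟙-*-∧-swap true  true  true  = refl
    𝟙-*-∧-swap true  true  false = refl
    𝟙-*-∧-swap true  false s     = sym (*-zeroʳ (𝟙 s))
    𝟙-*-∧-swap false true  true  = refl
    𝟙-*-∧-swap false true  false = refl
    𝟙-*-∧-swap false false s     = sym (*-zeroʳ (𝟙 s))
    swap : ∀ t z → 𝟙 (R t) * 𝟙 (E t z ∧ S z) ≡ 𝟙 (S z) * 𝟙 (E z t ∧ R t)
    swap t z = trans (cong (λ e → 𝟙 (R t) * 𝟙 (e ∧ S z)) (E-sym t z)) (𝟙-*-∧-swap (R t) (E z t) (S z))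

  ∣∣-by-level : (d : Fin n → ℕ) → (∀ z → d z ≤ 3) → (P : Pred n) → ∣ P ∣ ≡ Σ₄ (λ j → ∣ P ∩ level d j ∣)
  ∣∣-by-level d d≤3 P = trans (sum-cong-≗ (λ z → 𝟙-by-level d d≤3 (P z) z))
                              (∑-Σ₄ (λ j z → 𝟙 (P z ∧ level d j z)))

-- Graph distance

-- least p d is the least k ≤ d with p k, and d if there is none.
least : (ℕ → Bool) → ℕ → ℕ
least p zero    = 0
least p (suc d) = if p 0 then 0 else suc (least (p ∘ suc) d)

least-≤ : ∀ (p : ℕ → Bool) d → least p d ≤ d
least-≤ p zero    = z≤n
least-≤ p (suc d) with p 0
... | true  = z≤n
... | false = s≤s (least-≤ (p ∘ suc) d)

least-minimal : ∀ (p : ℕ → Bool) d k → T (p k) → least p d ≤ k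
least-minimal p zero    k       _  = z≤n
least-minimal p (suc d) k       pk with p 0 in p₀
least-minimal p (suc d) k       pk | true  = z≤n
least-minimal p (suc d) zero    pk | false = ⊥-elim (subst T p₀ pk)
least-minimal p (suc d) (suc k) pk | false = s≤s (least-minimal (p ∘ suc) d k pk)

least-satisfies : ∀ (p : ℕ → Bool) d → T (p d) → T (p (least p d))
least-satisfies p zero    pd = pd
least-satisfies p (suc d) pd with p 0 in p₀
... | true  = subst T (sym p₀) tt
... | false = least-satisfies (p ∘ suc) d pd

module GraphDistance {n : ℕ} (G : Graph n) where
  open Graph G renaming (sym to adj-comm; irrfl to adj-irrefl)

  private variable
    x y z : Fin n
    k m i : ℕ

  adj-sym : T (adj x y) → T (adj y x)
  adj-sym {x} {y} = subst T (adj-comm x y)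

  adj⇒≢ : T (adj x y) → x ≢ y
  adj⇒≢ {x} xy refl = subst T (adj-irrefl x) xy

  within-zero⇒≡ : ∀ x y → T (within G 0 x y) → x ≡ y
  within-zero⇒≡ x y = toWitness

  ≡⇒within-zero : x ≡ y → T (within G 0 x y)
  ≡⇒within-zero = fromWitness

  within-suc : ∀ k → T (within G k x y) → T (within G (suc k) x y)
  within-suc k w = T-∨ .from (inj₁ w)

  within-step : ∀ k → T (adj x z) → T (within G k z y) → T (within G (suc k) x y)
  within-step {x} {z} {y} k xz zy =
    T-∨ .from (inj₂ (any⁺ (λ z → adj x z ∧ within G k z y) (lose (∈-allFin z) (T-∧ .from (xz , zy)))))

  within-suc⁻ : ∀ k x y → T (within G (suc k) x y) →
                T (within G k x y) ⊎ ∃[ z ] (T (adj x z) × T (within G k z y))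
  within-suc⁻ k x y w with T-∨ .to w
  ... | inj₁ w′ = inj₁ w′
  ... | inj₂ a  = let (z , xzy) = satisfied (any⁻ (λ z → adj x z ∧ within G k z y) (allFin n) a) in
                  inj₂ (z , T-∧ .to xzy)

  within-stepʳ : ∀ k x y → T (within G k x z) → T (adj z y) → T (within G (suc k) x y)
  within-stepʳ {z} zero    x y xz zy with within-zero⇒≡ x z xz
  ... | refl = within-step 0 zy (≡⇒within-zero refl)
  within-stepʳ {z} (suc k) x y xz zy with within-suc⁻ k x z xz
  ... | inj₁ xz′            = within-suc (suc k) (within-stepʳ k x y xz′ zy)
  ... | inj₂ (u , xu , uz)  = within-step (suc k) xu (within-stepʳ k u y uz zy)

  within-sym : ∀ k x y → T (within G k x y) → T (within G k y x)
  within-sym zero    x y xy = ≡⇒within-zero (sym (within-zero⇒≡ x y xy))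
  within-sym (suc k) x y xy with within-suc⁻ k x y xy
  ... | inj₁ xy′           = within-suc k (within-sym k x y xy′)
  ... | inj₂ (z , xz , zy) = within-stepʳ k y x (within-sym k z y zy) (adj-sym xz)

  within-≤ : ∀ {k m} x y → k ≤ m → T (within G k x y) → T (within G m x y)
  within-≤ x y k≤m = go (≤⇒≤′ k≤m)
    where
    go : ∀ {m} → k ≤′ m → T (within G k x y) → T (within G m x y)
    go ≤′-refl          w = w
    go (≤′-step {m} k≤′m) w = within-suc m (go k≤′m w)

  module Metric (D : ℕ) (diameter : ∀ x y → T (within G D x y)) where

    dist : Fin n → Fin n → ℕ
    dist x y = least (λ k → within G k x y) D

    dist≤D : ∀ x y → dist x y ≤ D
    dist≤D x y = least-≤ (λ k → within G k x y) D

    within⇒dist≤ : ∀ k x y → T (within G k x y) → dist x y ≤ k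
    within⇒dist≤ k x y = least-minimal (λ k → within G k x y) D k

    dist≤⇒within : ∀ k x y → dist x y ≤ k → T (within G k x y)
    dist≤⇒within k x y d≤k = within-≤ x y d≤k (least-satisfies (λ k → within G k x y) D (diameter x y))

    dist-sym : ∀ x y → dist x y ≡ dist y x
    dist-sym x y = ≤-antisym (dist≤dist x y) (dist≤dist y x)
      where
      dist≤dist : ∀ x y → dist x y ≤ dist y x
      dist≤dist x y =
        within⇒dist≤ (dist y x) x y (within-sym (dist y x) y x (dist≤⇒within (dist y x) y x ≤-refl))

    dist≡0⇒≡ : dist x y ≡ 0 → x ≡ y
    dist≡0⇒≡ {x} {y} d≡0 = within-zero⇒≡ x y (dist≤⇒within 0 x y (≤-reflexive d≡0))

    dist-refl : ∀ x → dist x x ≡ 0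
    dist-refl x = n≤0⇒n≡0 (within⇒dist≤ 0 x x (≡⇒within-zero refl))

    dist-step : ∀ x z y → T (adj x z) → dist z y ≤ suc (dist x y)
    dist-step x z y xz =
      within⇒dist≤ _ z y (within-step (dist x y) (adj-sym xz) (dist≤⇒within (dist x y) x y ≤-refl))

    adj⇒dist≡1 : T (adj x y) → dist x y ≡ 1
    adj⇒dist≡1 {x} {y} xy = ≤-antisym (within⇒dist≤ 1 x y (within-step 0 xy (≡⇒within-zero refl)))
                                      (n≢0⇒n>0 (adj⇒≢ xy ∘ dist≡0⇒≡))

    dist≡1⇒adj : dist x y ≡ 1 → T (adj x y)
    dist≡1⇒adj {x} {y} d≡1 with within-suc⁻ 0 x y (dist≤⇒within 1 x y (≤-reflexive d≡1))
    ... | inj₁ xy with refl ← within-zero⇒≡ x y xy = ⊥-elim (0≢1+n (trans (sym (dist-refl x)) d≡1))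
    ... | inj₂ (z , xz , zy) with refl ← within-zero⇒≡ z y zy = xz

    atDist⇒dist : ∀ i x y → T (atDist G i x y) → dist x y ≡ i
    atDist⇒dist zero    x y w = n≤0⇒n≡0 (within⇒dist≤ 0 x y w)
    atDist⇒dist (suc i) x y w = let (w≤ , w≮) = T-∧ .to w in
      ≤-antisym (within⇒dist≤ (suc i) x y w≤) (≰⇒> λ d≤i → subst T (T-not-≡ .to w≮) (dist≤⇒within i x y d≤i))

    dist⇒atDist : ∀ i x y → dist x y ≡ i → T (atDist G i x y)
    dist⇒atDist zero    x y d≡0 = dist≤⇒within 0 x y (≤-reflexive d≡0)
    dist⇒atDist (suc i) x y d≡i =
      T-∧ .from (dist≤⇒within (suc i) x y (≤-reflexive d≡i) ,
                 ¬T⇒T-not λ w → <⇒≱ (≤-reflexive (sym d≡i)) (within⇒dist≤ i x y w))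

-- Strongly regular graphs with parameters (k, λ, μ) = (10, 4, 2)

module StronglyRegular-10-4-2
  {n : ℕ} (F : Fin n → Pred n)
  (F-sym    : ∀ {x y} → y ∈ F x → x ∈ F y)
  (F-irrefl : ∀ x → x ∉ F x)
  (valency  : ∀ x → ∣ F x ∣ ≡ 10)
  (λ-param  : ∀ {x y} → y ∈ F x → ∣ F x ∩ F y ∣ ≡ 4)
  (μ-param  : ∀ {x y} → x ≢ y → y ∉ F x → ∣ F x ∩ F y ∣ ≡ 2)
  where

  F⇒≢ : ∀ {x y} → y ∈ F x → x ≢ y
  F⇒≢ {x} Fxy refl = F-irrefl x Fxy

  common-nbrs-in-nbhd : ∀ {u v x} → u ≢ v → v ∉ F u → x ∈ F u → x ∈ F v →
                        ∣ F u ∩ (F x ∩ F v) ∣ ≤ 1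
  common-nbrs-in-nbhd {u} {v} {x} u≢v v∉Fu Fux Fvx =
    +-cancelʳ-≤ 1 _ 1 (begin
      ∣ F u ∩ (F x ∩ F v) ∣ + 1                        ≤⟨ +-monoʳ-≤ _ (∣∣-pos ((F u ∩ F v) ∖ F x) x∈rest) ⟩
      ∣ F u ∩ (F x ∩ F v) ∣ + ∣ (F u ∩ F v) ∖ F x ∣     ≡⟨ cong (_+ ∣ (F u ∩ F v) ∖ F x ∣) (∣∣-cong regroup) ⟩
      ∣ (F u ∩ F v) ∩ F x ∣ + ∣ (F u ∩ F v) ∖ F x ∣     ≡⟨ ∣∣-split (F u ∩ F v) (F x) ⟨
      ∣ F u ∩ F v ∣                                     ≡⟨ μ-param u≢v v∉Fu ⟩
      2                                                 ∎)
    where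
    open ≤-Reasoning
    x∈rest : x ∈ (F u ∩ F v) ∖ F x
    x∈rest = ∈∖⁺ (∈∩⁺ Fux Fvx) (F-irrefl x)
    regroup : ∀ z → F u z ∧ (F x z ∧ F v z) ≡ (F u z ∧ F v z) ∧ F x z
    regroup z with F u z | F x z | F v z
    ... | true  | true  | true  = refl
    ... | true  | true  | false = refl
    ... | true  | false | true  = refl
    ... | true  | false | false = refl
    ... | false | _     | _     = refl

  module Edge (x w : Fin n) (xw : w ∈ F x) where

    A M : Pred n
    A = F x ∩ F w
    M = F x ∖ (⁅ w ⁆ ∪ F w)

    M⁻ : ∀ {z} → z ∈ M → z ∈ F x × z ≢ w × z ∉ F w
    M⁻ Mz = let (Fxz , ∉w∪Fw) = ∈∖⁻ (F x) (⁅ w ⁆ ∪ F w) Mz in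
      Fxz , ∉w∪Fw ∘ ∈∪⁺ˡ (F w) ∘ ∈⁅⁆⁺ , ∉w∪Fw ∘ ∈∪⁺ʳ ⁅ w ⁆

    ∣∩F-x∣ : ∀ Q → ∣ Q ∩ F x ∣ ≡ 𝟙 (Q w) + ∣ Q ∩ A ∣ + ∣ Q ∩ M ∣
    ∣∩F-x∣ Q = trans (∣∣-pointwise₃ pointwise) (cong (λ k → k + ∣ Q ∩ A ∣ + ∣ Q ∩ M ∣) (∣∩⁅⁆∣ Q w))
      where
      pointwise : ∀ z → 𝟙 (Q z ∧ F x z) ≡ 𝟙 ((Q ∩ ⁅ w ⁆) z) + 𝟙 ((Q ∩ A) z) + 𝟙 ((Q ∩ M) z)
      pointwise z with z ≟ w
      ... | yes refl rewrite ∉⇒false (F-irrefl z) | ∈⇒true xw with Q z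
      ...   | true  = refl
      ...   | false = refl
      pointwise z | no _ with Q z | F x z | F w z
      ... | true  | true  | true  = refl
      ... | true  | true  | false = refl
      ... | true  | false | _     = refl
      ... | false | _     | _     = refl

    ∣M∣ : ∣ M ∣ ≡ 5
    ∣M∣ = +-cancelˡ-≡ 5 ∣ M ∣ 5 (begin
      5 + ∣ M ∣              ≡⟨ cong (λ a → 1 + a + ∣ M ∣) (λ-param xw) ⟨
      1 + ∣ A ∣ + ∣ M ∣      ≡⟨ ∣∩F-x∣ U ⟨
      ∣ F x ∣                ≡⟨ valency x ⟩
      10                     ∎)
      where open ≡-Reasoning

    few-A-nbrs : ∀ {z} → z ∈ M → ∣ F z ∩ A ∣ ≤ 1
    few-A-nbrs Mz = let (Fxz , z≢w , z∉Fw) = M⁻ Mz in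
      common-nbrs-in-nbhd z≢w (z∉Fw ∘ F-sym) (F-sym Fxz) (F-sym xw)

    many-M-nbrs : ∀ {z} → z ∈ M → 3 ≤ ∣ F z ∩ M ∣
    many-M-nbrs {z} Mz with M⁻ Mz
    ... | Fxz , _ , z∉Fw = +-cancelˡ-≤ 1 3 _ (begin
        4                                            ≡⟨ λ-param (F-sym Fxz) ⟨
        ∣ F z ∩ F x ∣                                ≡⟨ ∣∩F-x∣ (F z) ⟩
        𝟙 (F z w) + ∣ F z ∩ A ∣ + ∣ F z ∩ M ∣        ≤⟨ +-monoˡ-≤ _ (+-mono-≤ 𝟙[Fzw]≤0 (few-A-nbrs Mz)) ⟩
        1 + ∣ F z ∩ M ∣                              ∎)
      where
      open ≤-Reasoning
      𝟙[Fzw]≤0 : 𝟙 (F z w) ≤ 0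
      𝟙[Fzw]≤0 = 𝟙-mono (z∉Fw ∘ F-sym ∘ mk∈)

    -- Non-adjacent z, z′ ∈ M would each have ≥ 3 neighbours in the 3-element set M ∖ {z, z′}, hence 3
    -- common ones, while μ = 2 and the common neighbour x leave room for at most one inside Γ(x) ⊇ M.
    M-clique : ∀ {z z′} → z ∈ M → z′ ∈ M → z ≢ z′ → z′ ∈ F z
    M-clique {z} {z′} Mz Mz′ z≢z′ with F z z′ in Fzz′
    ... | true  = mk∈ (subst T (sym Fzz′) _)
    ... | false = ⊥-elim (from-no (6 ≤? 4) (begin
      3 + 3                                                   ≤⟨ +-mono-≤ (many-M-nbrs Mz) (many-M-nbrs Mz′) ⟩
      ∣ F z ∩ M ∣ + ∣ F z′ ∩ M ∣                              ≡⟨ ∣∣-∩-∪ (F z ∩ M) (F z′ ∩ M) ⟨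
      ∣ (F z ∩ M) ∩ (F z′ ∩ M) ∣ + ∣ (F z ∩ M) ∪ (F z′ ∩ M) ∣ ≤⟨ +-mono-≤ (∣∣-mono ∩⊆common) (∣∣-mono ∪⊆rest) ⟩
      ∣ F z ∩ (F x ∩ F z′) ∣ + ∣ (M ∖ ⁅ z ⁆) ∖ ⁅ z′ ⁆ ∣         ≤⟨ +-mono-≤ (common-nbrs-in-nbhd z≢z′ z′∉Fz
                                                                                          (Fzx Mz) (Fzx Mz′))
                                                                         (≤-reflexive ∣rest∣) ⟩
      1 + 3                                                   ∎))
      where
      open ≤-Reasoning
      z′∉Fz : z′ ∉ F z
      z′∉Fz (mk∈ Fzz′-holds) = subst T Fzz′ Fzz′-holds
      Fzx : ∀ {z} → z ∈ M → x ∈ F z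
      Fzx = F-sym ∘ proj₁ ∘ M⁻
      ∩⊆common : (F z ∩ M) ∩ (F z′ ∩ M) ⊆ F z ∩ (F x ∩ F z′)
      ∩⊆common v zv∩z′v = let (zv , z′v) = ∈∩⁻ (F z ∩ M) (F z′ ∩ M) zv∩z′v
                              (Fzv , Mv) = ∈∩⁻ (F z) M zv; (Fz′v , _) = ∈∩⁻ (F z′) M z′v in
        ∈∩⁺ Fzv (∈∩⁺ (proj₁ (M⁻ Mv)) Fz′v)
      ∪⊆rest : (F z ∩ M) ∪ (F z′ ∩ M) ⊆ (M ∖ ⁅ z ⁆) ∖ ⁅ z′ ⁆
      ∪⊆rest v zv∪z′v with ∈∪⁻ (F z ∩ M) (F z′ ∩ M) zv∪z′v
      ... | inj₁ zv = let (Fzv , Mv) = ∈∩⁻ (F z) M zv in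
        ∈∖⁺ (∈∖⁺ Mv (F⇒≢ Fzv ∘ sym ∘ ∈⁅⁆⁻)) (λ v≡z′ → z′∉Fz (subst (_∈ F z) (∈⁅⁆⁻ v≡z′) Fzv))
      ... | inj₂ z′v = let (Fz′v , Mv) = ∈∩⁻ (F z′) M z′v in
        ∈∖⁺ (∈∖⁺ Mv (λ v≡z → z′∉Fz (F-sym (subst (_∈ F z′) (∈⁅⁆⁻ v≡z) Fz′v)))) (F⇒≢ Fz′v ∘ sym ∘ ∈⁅⁆⁻)
      ∣rest∣ : ∣ (M ∖ ⁅ z ⁆) ∖ ⁅ z′ ⁆ ∣ ≡ 3
      ∣rest∣ = suc-injective (trans (sym (∣∣-remove (M ∖ ⁅ z ⁆) (∈∖⁺ Mz′ (z≢z′ ∘ sym ∘ ∈⁅⁆⁻))))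
                                    (suc-injective (trans (sym (∣∣-remove M Mz)) ∣M∣)))

    A-M-non-adjacent : ∀ {c z} → c ∈ A → z ∈ M → c ∉ F z
    A-M-non-adjacent {c} {z} Ac Mz Fzc = from-no (5 ≤? 4) (begin
      1 + 4                                         ≤⟨ +-mono-≤ (∣∣-pos (F z ∩ A) (∈∩⁺ Fzc Ac))
                                                                 (subst (_≤ ∣ F z ∩ M ∣) ∣M∖z∣ (∣∣-mono M∖z⊆FzM)) ⟩
      ∣ F z ∩ A ∣ + ∣ F z ∩ M ∣                      ≤⟨ +-monoˡ-≤ _ (m≤n+m _ (𝟙 (F z w))) ⟩
      𝟙 (F z w) + ∣ F z ∩ A ∣ + ∣ F z ∩ M ∣          ≡⟨ ∣∩F-x∣ (F z) ⟨
      ∣ F z ∩ F x ∣                                 ≡⟨ λ-param (F-sym (proj₁ (M⁻ Mz))) ⟩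
      4                                             ∎)
      where
      open ≤-Reasoning
      M∖z⊆FzM : M ∖ ⁅ z ⁆ ⊆ F z ∩ M
      M∖z⊆FzM v M∖zv = let (Mv , v∉z) = ∈∖⁻ M ⁅ z ⁆ M∖zv in ∈∩⁺ (M-clique Mz Mv (v∉z ∘ ∈⁅⁆⁺ ∘ sym)) Mv
      ∣M∖z∣ : ∣ M ∖ ⁅ z ⁆ ∣ ≡ 4
      ∣M∖z∣ = suc-injective (trans (sym (∣∣-remove M Mz)) ∣M∣)

    A-clique : ∀ {c c′} → c ∈ A → c′ ∈ A → c ≢ c′ → c′ ∈ F c
    A-clique {c} {c′} Ac Ac′ c≢c′ =
      proj₁ (∈∩⁻ (F c) A (⊆∧∣∣≥⇒⊇ FcA⊆A∖c (≤-reflexive (trans ∣A∖c∣ (sym ∣FcA∣)))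
                                   c′ (∈∖⁺ Ac′ (c≢c′ ∘ sym ∘ ∈⁅⁆⁻))))
      where
      open ≡-Reasoning
      Fxc : c ∈ F x
      Fxc = proj₁ (∈∩⁻ (F x) (F w) Ac)
      Fwc : c ∈ F w
      Fwc = proj₂ (∈∩⁻ (F x) (F w) Ac)
      FcA⊆A∖c : F c ∩ A ⊆ A ∖ ⁅ c ⁆
      FcA⊆A∖c v Fcv∩Av = let (Fcv , Av) = ∈∩⁻ (F c) A Fcv∩Av in ∈∖⁺ Av (F⇒≢ Fcv ∘ sym ∘ ∈⁅⁆⁻)
      ∣A∖c∣ : ∣ A ∖ ⁅ c ⁆ ∣ ≡ 3
      ∣A∖c∣ = suc-injective (trans (sym (∣∣-remove A Ac)) (λ-param xw))
      ∣FcM∣ : ∣ F c ∩ M ∣ ≡ 0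
      ∣FcM∣ = ∣∣-zero (λ v Fcv∩Mv → let (Fcv , Mv) = ∈∩⁻ (F c) M Fcv∩Mv in A-M-non-adjacent Ac Mv (F-sym Fcv))
      ∣FcA∣ : ∣ F c ∩ A ∣ ≡ 3
      ∣FcA∣ = sym (trans (suc-injective (begin
        4                                        ≡⟨ λ-param (F-sym Fxc) ⟨
        ∣ F c ∩ F x ∣                            ≡⟨ ∣∩F-x∣ (F c) ⟩
        𝟙 (F c w) + ∣ F c ∩ A ∣ + ∣ F c ∩ M ∣    ≡⟨ cong₂ (λ a b → a + ∣ F c ∩ A ∣ + b)
                                                           (cong 𝟙 (∈⇒true (F-sym Fwc))) ∣FcM∣ ⟩
        1 + ∣ F c ∩ A ∣ + 0                      ∎)) (+-identityʳ _))

    K : Pred n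
    K = ⁅ x ⁆ ∪ ⁅ w ⁆ ∪ A

    K⁻ : ∀ {c} → c ∈ K → c ≡ x ⊎ c ≡ w ⊎ c ∈ A
    K⁻ Kc with ∈∪⁻ ⁅ x ⁆ (⁅ w ⁆ ∪ A) Kc
    ... | inj₁ c≡x = inj₁ (∈⁅⁆⁻ c≡x)
    ... | inj₂ Kc′ with ∈∪⁻ ⁅ w ⁆ A Kc′
    ...   | inj₁ c≡w = inj₂ (inj₁ (∈⁅⁆⁻ c≡w))
    ...   | inj₂ Ac  = inj₂ (inj₂ Ac)

    K-clique : ∀ {c c′} → c ∈ K → c′ ∈ K → c ≢ c′ → c′ ∈ F c
    K-clique Kc Kc′ c≢c′ with K⁻ Kc | K⁻ Kc′
    ... | inj₁ refl        | inj₁ refl        = ⊥-elim (c≢c′ refl)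
    ... | inj₁ refl        | inj₂ (inj₁ refl) = xw
    ... | inj₁ refl        | inj₂ (inj₂ Ac′)  = proj₁ (∈∩⁻ (F x) (F w) Ac′)
    ... | inj₂ (inj₁ refl) | inj₁ refl        = F-sym xw
    ... | inj₂ (inj₁ refl) | inj₂ (inj₁ refl) = ⊥-elim (c≢c′ refl)
    ... | inj₂ (inj₁ refl) | inj₂ (inj₂ Ac′)  = proj₂ (∈∩⁻ (F x) (F w) Ac′)
    ... | inj₂ (inj₂ Ac)   | inj₁ refl        = F-sym (proj₁ (∈∩⁻ (F x) (F w) Ac))
    ... | inj₂ (inj₂ Ac)   | inj₂ (inj₁ refl) = F-sym (proj₂ (∈∩⁻ (F x) (F w) Ac))
    ... | inj₂ (inj₂ Ac)   | inj₂ (inj₂ Ac′)  = A-clique Ac Ac′ c≢c′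

    ∣K∣ : ∣ K ∣ ≡ 6
    ∣K∣ = begin
      ∣ ⁅ x ⁆ ∪ ⁅ w ⁆ ∪ A ∣          ≡⟨ ∣∣-disjoint-∪ x∉w∪A ⟩
      ∣ ⁅ x ⁆ ∣ + ∣ ⁅ w ⁆ ∪ A ∣      ≡⟨ cong₂ _+_ (∣⁅⁆∣ x) (∣∣-disjoint-∪ w∉A) ⟩
      1 + (∣ ⁅ w ⁆ ∣ + ∣ A ∣)        ≡⟨ cong₂ (λ a b → 1 + (a + b)) (∣⁅⁆∣ w) (λ-param xw) ⟩
      6                              ∎
      where
      open ≡-Reasoning
      w∉A : ∀ v → v ∈ ⁅ w ⁆ → v ∈ A → ⊥
      w∉A v v≡w Av with refl ← ∈⁅⁆⁻ v≡w = F-irrefl w (proj₂ (∈∩⁻ (F x) (F w) Av))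
      x∉w∪A : ∀ v → v ∈ ⁅ x ⁆ → v ∈ ⁅ w ⁆ ∪ A → ⊥
      x∉w∪A v v≡x v∈w∪A with refl ← ∈⁅⁆⁻ v≡x | ∈∪⁻ ⁅ w ⁆ A v∈w∪A
      ... | inj₁ x≡w = F⇒≢ xw (∈⁅⁆⁻ x≡w)
      ... | inj₂ Ax  = F-irrefl x (proj₁ (∈∩⁻ (F x) (F w) Ax))

-- Perfect codes by sphere packing

module ClosedNeighbourhoods {n : ℕ} (G : Graph n) where
  open Graph G using (adj) renaming (sym to adj-comm; irrfl to adj-irrefl)

  N[_] : Fin n → Pred n
  N[ v ] = ⁅ v ⁆ ∪ adj v

  N-sym : ∀ u v → N[ u ] v ≡ N[ v ] u
  N-sym u v rewrite adj-comm u v with v ≟ u | u ≟ v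
  ... | yes refl | yes _    = refl
  ... | yes refl | no  u≢u  = ⊥-elim (u≢u refl)
  ... | no  v≢u  | yes refl = ⊥-elim (v≢u refl)
  ... | no  _    | no  _    = refl

  ∣N[]∣ : ∀ v → ∣ N[ v ] ∣ ≡ suc ∣ adj v ∣
  ∣N[]∣ v = trans (∣∣-disjoint-∪ v∉adj) (cong (_+ ∣ adj v ∣) (∣⁅⁆∣ v))
    where
    v∉adj : ∀ u → u ∈ ⁅ v ⁆ → u ∈ adj v → ⊥
    v∉adj u u≡v (mk∈ vu) with refl ← ∈⁅⁆⁻ u≡v = subst T (adj-irrefl u) vu

  sphere-packing : (C : Pred n) (s : ℕ) → (∀ v → ∣ N[ v ] ∣ ≡ s) → s * ∣ C ∣ ≡ n →
                   (∀ v c c′ → c ∈ C ∩ N[ v ] → c′ ∈ C ∩ N[ v ] → c ≡ c′) →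
                   ∀ v → ∣ C ∩ N[ v ] ∣ ≡ 1
  sphere-packing C s ∣N∣≡s s∣C∣≡n unique v =
    trans (∣∣-∩-comm C N[ v ]) (∑∈-≤1-≡1 U at-most-one covered v (mk∈ tt))
    where
    at-most-one : ∀ v → v ∈ U → ∣ N[ v ] ∩ C ∣ ≤ 1
    at-most-one v _ = ≤-trans (≤-reflexive (∣∣-∩-comm N[ v ] C)) (∣∣-≤1 (C ∩ N[ v ]) (unique v))
    covered : ∣ U ∣ ≤ ∑[ v ∈ U ] ∣ N[ v ] ∩ C ∣
    covered = ≤-reflexive (begin
      ∣ U ∣                          ≡⟨ ∣U∣ ⟩
      n                              ≡⟨ s∣C∣≡n ⟨
      s * ∣ C ∣                      ≡⟨ ∑∈-const C s (λ c _ → trans (∣∣-cong (∧-identityʳ ∘ N[ c ])) (∣N∣≡s c)) ⟨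
      ∑[ c ∈ C ] ∣ N[ c ] ∩ U ∣      ≡⟨ ∑∈-swap N[_] N-sym U C ⟨
      ∑[ v ∈ U ] ∣ N[ v ] ∩ C ∣      ∎)
      where open ≡-Reasoning

-- The intersection array {5,4,2;1,1,4}

module DistanceRegular-5-4-2-1-1-4 {n : ℕ} (G : Graph n) (drg : IsDRG-5-4-2-1-1-4 G) where
  open Graph G using (adj)
  open GraphDistance G
  open Metric 3 (proj₁ (proj₁ drg)) public

  Γ : ℕ → Fin n → Pred n
  Γ j y = level (dist y) j

  ∈Γ⁺ : ∀ y {j z} → dist y z ≡ j → z ∈ Γ j y
  ∈Γ⁺ y = ∈level⁺ (dist y)

  ∈Γ⁻ : ∀ y {j z} → z ∈ Γ j y → dist y z ≡ j
  ∈Γ⁻ y = ∈level⁻ (dist y)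

  p¹ : Fin n → ℕ → Fin n → ℕ
  p¹ x j y = ∣ adj x ∩ Γ j y ∣

  nbrsAtDist≡p¹ : ∀ x j y → nbrsAtDist G x j y ≡ p¹ x j y
  nbrsAtDist≡p¹ x j y = trans (count≡∣∣ G (adj x ∩ At)) (∣∣-cong-⊆ At⊆Γ Γ⊆At)
    where
    At : Pred n
    At z = atDist G j z y
    At⊆Γ : adj x ∩ At ⊆ adj x ∩ Γ j y
    At⊆Γ z h = let (xz , zy) = ∈∩⁻ (adj x) At h in
      ∈∩⁺ xz (∈Γ⁺ y (trans (dist-sym y z) (atDist⇒dist j z y (holds zy))))
    Γ⊆At : adj x ∩ Γ j y ⊆ adj x ∩ At
    Γ⊆At z h = let (xz , yz) = ∈∩⁻ (adj x) (Γ j y) h in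
      ∈∩⁺ xz (mk∈ (dist⇒atDist j z y (trans (dist-sym z y) (∈Γ⁻ y yz))))

  from-hypothesis : ∀ i {j c} → (∀ x y → T (atDist G i x y) → nbrsAtDist G x j y ≡ c) →
                    ∀ {x y} → dist x y ≡ i → p¹ x j y ≡ c
  from-hypothesis i hyp {x} {y} d≡i = trans (sym (nbrsAtDist≡p¹ x _ y)) (hyp x y (dist⇒atDist i x y d≡i))

  b₀ : ∀ x → p¹ x 1 x ≡ 5
  b₀ x = from-hypothesis 0 (proj₁ (proj₂ drg)) (dist-refl x)

  b₁c₁ : ∀ {x y} → dist x y ≡ 1 → p¹ x 2 y ≡ 4 × p¹ x 0 y ≡ 1
  b₁c₁ d≡1 = from-hypothesis 1 (λ x y → proj₁ ∘ proj₁ (proj₂ (proj₂ drg)) x y) d≡1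
           , from-hypothesis 1 (λ x y → proj₂ ∘ proj₁ (proj₂ (proj₂ drg)) x y) d≡1

  b₂c₂ : ∀ {x y} → dist x y ≡ 2 → p¹ x 3 y ≡ 2 × p¹ x 1 y ≡ 1
  b₂c₂ d≡2 = from-hypothesis 2 (λ x y → proj₁ ∘ proj₁ (proj₂ (proj₂ (proj₂ drg))) x y) d≡2
           , from-hypothesis 2 (λ x y → proj₂ ∘ proj₁ (proj₂ (proj₂ (proj₂ drg))) x y) d≡2

  c₃ : ∀ {x y} → dist x y ≡ 3 → p¹ x 2 y ≡ 4
  c₃ = from-hypothesis 3 (proj₂ (proj₂ (proj₂ (proj₂ drg))))

  valency : ∀ x → ∣ adj x ∣ ≡ 5
  valency x = trans (∣∣-cong-⊆ (λ z xz → ∈∩⁺ xz (∈Γ⁺ x (adj⇒dist≡1 (holds xz))))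
                               (λ z h → proj₁ (∈∩⁻ (adj x) (Γ 1 x) h)))
                    (b₀ x)

  p¹-row : ∀ x y → Σ₄ (λ j → p¹ x j y) ≡ 5
  p¹-row x y = trans (sym (∣∣-by-level (dist y) (dist≤D y) (adj x))) (valency x)

  p¹-zero : ∀ {x j y} → (∀ {z} → z ∈ adj x → dist y z ≢ j) → p¹ x j y ≡ 0
  p¹-zero {x} {j} {y} far = ∣∣-zero (λ z h → let (xz , yz) = ∈∩⁻ (adj x) (Γ j y) h in far xz (∈Γ⁻ y yz))

  p¹-above : ∀ {x j y h} → dist x y ≡ h → 2 + h ≤ j → p¹ x j y ≡ 0
  p¹-above {x} {j} {y} refl 2+h≤j = p¹-zero λ {z} xz yz≡j →
    1+n≰n (≤-trans 2+h≤j (subst (_≤ suc (dist x y)) (trans (dist-sym z y) yz≡j)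
                                (dist-step x z y (holds xz))))

  p¹-below : ∀ {x j y h} → dist x y ≡ h → 2 + j ≤ h → p¹ x j y ≡ 0
  p¹-below {x} {j} {y} refl 2+j≤h = p¹-zero λ {z} xz yz≡j →
    1+n≰n (≤-trans 2+j≤h (subst (λ d → dist x y ≤ suc d) (trans (dist-sym z y) yz≡j)
                                (dist-step z x y (adj-sym (holds xz)))))

  p¹-beyond : ∀ {x j y} → 4 ≤ j → p¹ x j y ≡ 0
  p¹-beyond {y = y} 4≤j = p¹-zero λ {z} _ yz≡j → 1+n≰n (≤-trans 4≤j (subst (_≤ 3) yz≡j (dist≤D y z)))

  -- P₁ h j is the intersection number p^h_{1j} of the array.
  P₁ : ℕ → ℕ → ℕ
  P₁ 0 1 = 5
  P₁ 1 0 = 1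
  P₁ 1 2 = 4
  P₁ 2 1 = 1
  P₁ 2 2 = 2
  P₁ 2 3 = 2
  P₁ 3 2 = 4
  P₁ 3 3 = 1
  P₁ _ _ = 0

  -- In each row three entries come from the array or the triangle inequality; the row sum 5 gives
  -- the fourth.
  p¹≡P₁ : ∀ x j y → p¹ x j y ≡ P₁ (dist x y) j
  p¹≡P₁ x j y with dist x y in h | dist≤D x y
  ... | 0 | _ with refl ← dist≡0⇒≡ h = row₀ j
    where
    row₀ : ∀ j → p¹ x j x ≡ P₁ 0 j
    row₀ 0 = p¹-zero (λ xz d≡0 → adj⇒≢ (holds xz) (dist≡0⇒≡ d≡0))
    row₀ 1 = b₀ x
    row₀ 2 = p¹-above h ≤-refl
    row₀ 3 = p¹-above h (s≤s (s≤s z≤n))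
    row₀ (suc (suc (suc (suc j)))) = p¹-beyond {y = y} (s≤s (s≤s (s≤s (s≤s z≤n))))
  ... | 1 | _ = row₁ j
    where
    row₁ : ∀ j → p¹ x j y ≡ P₁ 1 j
    row₁ 0 = proj₂ (b₁c₁ h)
    row₁ 1 with p¹-row x y
    ... | row rewrite proj₂ (b₁c₁ h) | proj₁ (b₁c₁ h) | p¹-above h ≤-refl =
      +-cancelʳ-≡ 4 _ 0 (trans (sym (+-identityʳ _)) (suc-injective row))
    row₁ 2 = proj₁ (b₁c₁ h)
    row₁ 3 = p¹-above h ≤-refl
    row₁ (suc (suc (suc (suc j)))) = p¹-beyond {y = y} (s≤s (s≤s (s≤s (s≤s z≤n))))
  ... | 2 | _ = row₂ j
    where
    row₂ : ∀ j → p¹ x j y ≡ P₁ 2 j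
    row₂ 0 = p¹-below h ≤-refl
    row₂ 1 = proj₂ (b₂c₂ h)
    row₂ 2 with p¹-row x y
    ... | row rewrite p¹-below h ≤-refl | proj₂ (b₂c₂ h) | proj₁ (b₂c₂ h) =
      +-cancelʳ-≡ 2 _ 2 (suc-injective row)
    row₂ 3 = proj₁ (b₂c₂ h)
    row₂ (suc (suc (suc (suc j)))) = p¹-beyond {y = y} (s≤s (s≤s (s≤s (s≤s z≤n))))
  ... | 3 | _ = row₃ j
    where
    row₃ : ∀ j → p¹ x j y ≡ P₁ 3 j
    row₃ 0 = p¹-below h (s≤s (s≤s z≤n))
    row₃ 1 = p¹-below h ≤-refl
    row₃ 2 = c₃ h
    row₃ 3 with p¹-row x y
    ... | row rewrite p¹-below h (s≤s (s≤s z≤n)) | p¹-below h ≤-refl | c₃ h = +-cancelˡ-≡ 4 _ 1 row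
    row₃ (suc (suc (suc (suc j)))) = p¹-beyond {y = y} (s≤s (s≤s (s≤s (s≤s z≤n))))
  ... | suc (suc (suc (suc _))) | s≤s (s≤s (s≤s ()))

  ∣∩Γ₀∣ : ∀ P y → ∣ P ∩ Γ 0 y ∣ ≡ 𝟙 (P y)
  ∣∩Γ₀∣ P y = trans (∣∣-cong-⊆ Γ₀⊆⁅y⁆ ⁅y⁆⊆Γ₀) (∣∩⁅⁆∣ P y)
    where
    Γ₀⊆⁅y⁆ : P ∩ Γ 0 y ⊆ P ∩ ⁅ y ⁆
    Γ₀⊆⁅y⁆ z h = let (Pz , yz) = ∈∩⁻ P (Γ 0 y) h in ∈∩⁺ Pz (∈⁅⁆⁺ (sym (dist≡0⇒≡ (∈Γ⁻ y yz))))
    ⁅y⁆⊆Γ₀ : P ∩ ⁅ y ⁆ ⊆ P ∩ Γ 0 y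
    ⁅y⁆⊆Γ₀ z h = let (Pz , z≡y) = ∈∩⁻ P ⁅ y ⁆ h in
                ∈∩⁺ Pz (∈Γ⁺ y (trans (cong (dist y) (∈⁅⁆⁻ z≡y)) (dist-refl y)))

  ∣∩Γ₁∣ : ∀ P y → ∣ P ∩ Γ 1 y ∣ ≡ ∣ P ∩ adj y ∣
  ∣∩Γ₁∣ P y = ∣∣-cong-⊆ (λ z h → let (Pz , yz) = ∈∩⁻ P (Γ 1 y) h in ∈∩⁺ Pz (mk∈ (dist≡1⇒adj (∈Γ⁻ y yz))))
                        (λ z h → let (Pz , yz) = ∈∩⁻ P (adj y) h in ∈∩⁺ Pz (∈Γ⁺ y (adj⇒dist≡1 (holds yz))))

  ∑∈-by-dist : ∀ y Q (g : ℕ → ℕ) → ∑[ z ∈ Q ] g (dist y z) ≡ Σ₄ (λ j → g j * ∣ Q ∩ Γ j y ∣)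
  ∑∈-by-dist y Q g = trans (∑∈-by-level (dist y) (dist≤D y) Q (g ∘ dist y))
                           (Σ₄-cong (λ j → ∑∈-const (Q ∩ Γ j y) (g j)
                                             (λ z h → cong g (∈Γ⁻ y (proj₂ (∈∩⁻ Q (Γ j y) h))))))

  two-step-walks : ∀ q P → ∑[ t ∈ adj q ] ∣ adj t ∩ P ∣ ≡ 5 * 𝟙 (P q) + ∣ P ∩ Γ 2 q ∣
  two-step-walks q P = begin
    ∑[ t ∈ adj q ] ∣ adj t ∩ P ∣                 ≡⟨ ∑∈-swap adj (Graph.sym G) (adj q) P ⟩
    ∑[ z ∈ P ] ∣ adj z ∩ adj q ∣                 ≡⟨ ∑∈-cong P (λ z _ → trans (sym (∣∩Γ₁∣ (adj z) q))
                                                                            (p¹≡P₁ z 1 q)) ⟩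
    ∑[ z ∈ P ] P₁ (dist z q) 1                   ≡⟨ ∑∈-cong P (λ z _ → cong (λ d → P₁ d 1) (dist-sym z q)) ⟩
    ∑[ z ∈ P ] P₁ (dist q z) 1                   ≡⟨ ∑∈-by-dist q P (λ j → P₁ j 1) ⟩
    Σ₄ (λ j → P₁ j 1 * ∣ P ∩ Γ j q ∣)            ≡⟨ cong (λ a → 5 * a + 0 + (∣ P ∩ Γ 2 q ∣ + 0) + 0) (∣∩Γ₀∣ P q) ⟩
    5 * 𝟙 (P q) + 0 + (∣ P ∩ Γ 2 q ∣ + 0) + 0    ≡⟨ solve-zeros (5 * 𝟙 (P q)) ∣ P ∩ Γ 2 q ∣ ⟩
    5 * 𝟙 (P q) + ∣ P ∩ Γ 2 q ∣                  ∎
    where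
    open ≡-Reasoning
    solve-zeros : ∀ a b → a + 0 + (b + 0) + 0 ≡ a + b
    solve-zeros a b rewrite +-identityʳ a | +-identityʳ b | +-identityʳ (a + b) = refl

  k₂ : ∀ y → ∣ Γ 2 y ∣ ≡ 20
  k₂ y = +-cancelˡ-≡ 5 _ 20 (begin
    5 + ∣ Γ 2 y ∣                  ≡⟨ two-step-walks y U ⟨
    ∑[ t ∈ adj y ] ∣ adj t ∩ U ∣   ≡⟨ ∑∈-const (adj y) 5 (λ t _ → trans (∣∣-cong (∧-identityʳ ∘ adj t)) (valency t)) ⟩
    5 * ∣ adj y ∣                  ≡⟨ cong (5 *_) (valency y) ⟩
    25                             ∎)
    where open ≡-Reasoning

  k₃ : ∀ y → ∣ Γ 3 y ∣ ≡ 10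
  k₃ y = *-cancelˡ-≡ _ 10 4 (begin
    4 * ∣ Γ 3 y ∣                               ≡⟨ ∑∈-const (Γ 3 y) 4 (λ z h → c₃ (at z h)) ⟨
    ∑[ z ∈ Γ 3 y ] ∣ adj z ∩ Γ 2 y ∣            ≡⟨ ∑∈-swap adj (Graph.sym G) (Γ 2 y) (Γ 3 y) ⟨
    ∑[ t ∈ Γ 2 y ] ∣ adj t ∩ Γ 3 y ∣            ≡⟨ ∑∈-const (Γ 2 y) 2 (λ t h → proj₁ (b₂c₂ (at t h))) ⟩
    2 * ∣ Γ 2 y ∣                               ≡⟨ cong (2 *_) (k₂ y) ⟩
    40                                          ∎)
    where
    open ≡-Reasoning
    at : ∀ {j} z → z ∈ Γ j y → dist z y ≡ j
    at z h = trans (dist-sym z y) (∈Γ⁻ y h)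

  n≡36 : Fin n → n ≡ 36
  n≡36 x = begin
    n                                                   ≡⟨ ∣U∣ ⟨
    ∣ U ∣                                               ≡⟨ ∣∣-by-level (dist x) (dist≤D x) U ⟩
    ∣ Γ 0 x ∣ + ∣ Γ 1 x ∣ + ∣ Γ 2 x ∣ + ∣ Γ 3 x ∣       ≡⟨ cong₂ (λ a b → a + b + ∣ Γ 2 x ∣ + ∣ Γ 3 x ∣)
                                                                 (∣∩Γ₀∣ U x) (trans (∣∩Γ₁∣ U x) (valency x)) ⟩
    6 + ∣ Γ 2 x ∣ + ∣ Γ 3 x ∣                           ≡⟨ cong₂ (λ a b → 6 + a + b) (k₂ x) (k₃ x) ⟩
    36                                                  ∎
    where open ≡-Reasoning

  ∣Γ₃∣-by-dist : ∀ p q → ∣ Γ 3 p ∣ ≡ 𝟙 (Γ 3 p q) + P₁ (dist q p) 3 + ∣ Γ 3 p ∩ Γ 2 q ∣ + ∣ Γ 3 p ∩ Γ 3 q ∣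
  ∣Γ₃∣-by-dist p q = trans (∣∣-by-level (dist q) (dist≤D q) (Γ 3 p))
    (cong₂ (λ a b → a + b + ∣ Γ 3 p ∩ Γ 2 q ∣ + ∣ Γ 3 p ∩ Γ 3 q ∣)
           (∣∩Γ₀∣ (Γ 3 p) q)
           (trans (∣∩Γ₁∣ (Γ 3 p) q) (trans (∣∣-∩-comm (Γ 3 p) (adj q)) (p¹≡P₁ q 3 p))))

  ∣Γ₃∩Γ₂∣ : ∀ p q → 5 * 𝟙 (Γ 3 p q) + ∣ Γ 3 p ∩ Γ 2 q ∣ ≡ Σ₄ (λ j → P₁ j 3 * P₁ (dist q p) j)
  ∣Γ₃∩Γ₂∣ p q = begin
    5 * 𝟙 (Γ 3 p q) + ∣ Γ 3 p ∩ Γ 2 q ∣          ≡⟨ two-step-walks q (Γ 3 p) ⟨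
    ∑[ t ∈ adj q ] p¹ t 3 p                      ≡⟨ ∑∈-cong (adj q) (λ t _ → trans (p¹≡P₁ t 3 p)
                                                                              (cong (λ d → P₁ d 3) (dist-sym t p))) ⟩
    ∑[ t ∈ adj q ] P₁ (dist p t) 3               ≡⟨ ∑∈-by-dist p (adj q) (λ j → P₁ j 3) ⟩
    Σ₄ (λ j → P₁ j 3 * p¹ q j p)                 ≡⟨ Σ₄-cong (λ j → cong (P₁ j 3 *_) (p¹≡P₁ q j p)) ⟩
    Σ₄ (λ j → P₁ j 3 * P₁ (dist q p) j)          ∎
    where open ≡-Reasoning

  λ₃ : ∀ {p q} → dist p q ≡ 3 → ∣ Γ 3 p ∩ Γ 3 q ∣ ≡ 4
  λ₃ {p} {q} d≡3 with ∣Γ₃∣-by-dist p q | ∣Γ₃∩Γ₂∣ p q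
  ... | partition | walks rewrite d≡3 | trans (dist-sym q p) d≡3 | k₃ p =
    +-cancelˡ-≡ 6 _ 4 (sym (trans partition (cong (λ X → 2 + X + ∣ Γ 3 p ∩ Γ 3 q ∣) (+-cancelˡ-≡ 5 _ 4 walks))))

  μ₃ : ∀ {p q} → dist p q ≡ 1 ⊎ dist p q ≡ 2 → ∣ Γ 3 p ∩ Γ 3 q ∣ ≡ 2
  μ₃ {p} {q} d≡1∨2 with ∣Γ₃∣-by-dist p q | ∣Γ₃∩Γ₂∣ p q
  μ₃ {p} {q} (inj₁ d≡1) | partition | walks rewrite d≡1 | trans (dist-sym q p) d≡1 | k₃ p =
    +-cancelˡ-≡ 8 _ 2 (sym (trans partition (cong (_+ ∣ Γ 3 p ∩ Γ 3 q ∣) walks)))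
  μ₃ {p} {q} (inj₂ d≡2) | partition | walks rewrite d≡2 | trans (dist-sym q p) d≡2 | k₃ p =
    +-cancelˡ-≡ 8 _ 2 (sym (trans partition (cong (λ X → 2 + X + ∣ Γ 3 p ∩ Γ 3 q ∣) walks)))

  Γ₃-sym : ∀ {x y} → y ∈ Γ 3 x → x ∈ Γ 3 y
  Γ₃-sym {x} {y} h = ∈Γ⁺ y (trans (dist-sym y x) (∈Γ⁻ x h))

  Γ₃-irrefl : ∀ x → x ∉ Γ 3 x
  Γ₃-irrefl x h with () ← trans (sym (dist-refl x)) (∈Γ⁻ x h)

  Γ₃-μ : ∀ {x y} → x ≢ y → y ∉ Γ 3 x → ∣ Γ 3 x ∩ Γ 3 y ∣ ≡ 2
  Γ₃-μ {x} {y} x≢y y∉Γ₃x with dist x y in d | dist≤D x y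
  ... | 0 | _ = ⊥-elim (x≢y (dist≡0⇒≡ d))
  ... | 1 | _ = μ₃ (inj₁ d)
  ... | 2 | _ = μ₃ (inj₂ d)
  ... | 3 | _ = ⊥-elim (y∉Γ₃x (∈Γ⁺ x d))
  ... | suc (suc (suc (suc _))) | s≤s (s≤s (s≤s ()))

  module Γ₃ = StronglyRegular-10-4-2 (λ x → Γ 3 x) Γ₃-sym Γ₃-irrefl k₃ (λ {x} → λ₃ ∘ ∈Γ⁻ x) Γ₃-μ

  open ClosedNeighbourhoods G

  N-step : ∀ {v c} y → c ∈ N[ v ] → dist c y ≤ suc (dist v y)
  N-step {v} y c∈Nv with ∈∪⁻ ⁅ v ⁆ (adj v) c∈Nv
  ... | inj₁ c≡v with refl ← ∈⁅⁆⁻ c≡v = n≤1+n (dist v y)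
  ... | inj₂ vc = dist-step v _ y (holds vc)

  N-close : ∀ {v c c′} → c ∈ N[ v ] → c′ ∈ N[ v ] → dist c c′ ≤ 2
  N-close {v} {c} {c′} c∈Nv c′∈Nv = ≤-trans (N-step c′ c∈Nv) (s≤s (begin
    dist v c′       ≡⟨ dist-sym v c′ ⟩
    dist c′ v       ≤⟨ N-step v c′∈Nv ⟩
    suc (dist v v)  ≡⟨ cong suc (dist-refl v) ⟩
    1               ∎))
    where open ≤-Reasoning

  Γ₃-clique⇒perfect-code : (C : Pred n) → (∀ {c c′} → c ∈ C → c′ ∈ C → c ≢ c′ → c′ ∈ Γ 3 c) → ∣ C ∣ ≡ 6 →
                           IsPerfect1Code G C
  Γ₃-clique⇒perfect-code C clique ∣C∣≡6 v = begin
    count G (λ c → C c ∧ (⌊ c ≟ v ⌋ ∨ adj c v))     ≡⟨ count≡∣∣ G _ ⟩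
    ∣ (λ c → C c ∧ (⌊ c ≟ v ⌋ ∨ adj c v)) ∣         ≡⟨ ∣∣-cong (λ c → cong (λ b → C c ∧ (⌊ c ≟ v ⌋ ∨ b))
                                                                            (Graph.sym G c v)) ⟩
    ∣ C ∩ N[ v ] ∣                                 ≡⟨ sphere-packing C 6 ∣N[]∣≡6 6∣C∣≡n unique v ⟩
    1                                              ∎
    where
    open ≡-Reasoning
    6∣C∣≡n : 6 * ∣ C ∣ ≡ n
    6∣C∣≡n = trans (cong (6 *_) ∣C∣≡6) (sym (n≡36 v))
    ∣N[]∣≡6 : ∀ u → ∣ N[ u ] ∣ ≡ 6
    ∣N[]∣≡6 u = trans (∣N[]∣ u) (cong suc (valency u))
    unique : ∀ u c c′ → c ∈ C ∩ N[ u ] → c′ ∈ C ∩ N[ u ] → c ≡ c′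
    unique u c c′ c∈ c′∈ with c ≟ c′
    ... | yes c≡c′ = c≡c′
    ... | no  c≢c′ =
      let (Cc , c∈Nu) = ∈∩⁻ C N[ u ] c∈; (Cc′ , c′∈Nu) = ∈∩⁻ C N[ u ] c′∈ in
      ⊥-elim (1+n≰n (subst (_≤ 2) (∈Γ⁻ c (clique Cc Cc′ c≢c′)) (N-close c∈Nu c′∈Nu)))

proposition5p3 : (n : ℕ) (G : Graph n) → IsDRG-5-4-2-1-1-4 G →
    ∃[ C ] IsPerfect1Code G C
proposition5p3 n G drg with proj₂ (proj₁ drg)
... | x , w , d[x,w]≡3 = K , Γ₃-clique⇒perfect-code K K-clique ∣K∣
  where
  open DistanceRegular-5-4-2-1-1-4 G drg
  open Γ₃.Edge x w (∈Γ⁺ x (atDist⇒dist 3 x w d[x,w]≡3))
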